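{- For every $k \geq 2$, the vertex $u = (0,\dots,0,2,1)$ of the DCell graph $D_{k,2}$ (label with $k+1$ coordinates, all equal to $0$ except the last two, which are $2$ and $1$) is contained in exactly one cycle of length $6$ of $D_{k,2}$.
   Context: DCell graphs $D_{k,n}$ ($k \geq 0$, $n \geq 2$) are defined recursively. $D_{0,n}$ is the complete graph $K_n$ on vertices labeled $0,1,\dots,n-1$. Let $t_{k,n}$ denote the number of vertices of $D_{k,n}$. For $k \geq 1$, $D_{k,n}$ consists of $t_{k-1,n}+1$ disjoint copies $D^i_{k-1,n}$, $i = 0,1,\dots,t_{k-1,n}$, of $D_{k-1,n}$; a vertex of $D^i_{k-1,n}$ is labeled $(i,a_{k-1},\dots,a_0)$, where $(a_{k-1},\dots,a_0)$ is its label in $D_{k-1,n}$ (so $a_0 \in \{0,\dots,n-1\}$ and vertices of $D_{k,n}$ have labels with $k+1$ coordinates). For a suffix $(a_j,\dots,a_0)$ define $uid_j = a_0 + \sum_{l=1}^{j} a_l\, t_{l-1,n}$. Besides the edges inside the copies, for every pair $a<b$ of copy indices there is exactly one additional edge, joining the vertex of $D^a_{k-1,n}$ whose suffix has $uid_{k-1} = b-1$ to the vertex of $D^b_{k-1,n}$ whose suffix has $uid_{k-1} = a$. -}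

module Defs where

open import Data.Nat using (ℕ; zero; suc; _+_; _*_; _<_)
open import Data.Nat.DivMod using (_%_; m%n<n)
open import Data.Fin using (Fin; toℕ; fromℕ<)
open import Data.Product using (Σ; _×_; _,_; ∃)
open import Data.Sum using (_⊎_)
open import Relation.Binary.PropositionalEquality using (_≡_; _≢_)
open import Function.Definitions using (Injective)

-- t n k = number of vertices of D_{k,n}
t : ℕ → ℕ → ℕ
t n zero    = n
t n (suc k) = suc (t n k) * t n k

-- vertex labels of D_{k,n}: (a_k, …, a_0) with a_0 ∈ {0..n-1} and
-- a_j ∈ {0..t_{j-1,n}} for j ≥ 1 (copy index at level j); the head
-- of the pair is the leftmost (most significant) coordinate.
V : ℕ → ℕ → Set
V n zero    = Fin n
V n (suc k) = Fin (suc (t n k)) × V n k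

uid : (n k : ℕ) → V n k → ℕ
uid n zero    a       = toℕ a
uid n (suc k) (i , x) = uid n k x + toℕ i * t n k

Adj : (n k : ℕ) → V n k → V n k → Set
Adj n zero    a b = a ≢ b
Adj n (suc k) (i , x) (j , y) =
    (i ≡ j × Adj n k x y)
  ⊎ (toℕ i < toℕ j × suc (uid n k x) ≡ toℕ j × uid n k y ≡ toℕ i)
  ⊎ (toℕ j < toℕ i × suc (uid n k y) ≡ toℕ i × uid n k x ≡ toℕ j)

_⊕_ : Fin 6 → Fin 6 → Fin 6
r ⊕ i = fromℕ< (m%n<n (toℕ r + toℕ i) 6)

_⊖_ : Fin 6 → Fin 6 → Fin 6
r ⊖ i = fromℕ< (m%n<n (toℕ r + (6 Data.Nat.∸ toℕ i)) 6)

one : Fin 6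
one = Fin.suc Fin.zero

record Cycle6 (n k : ℕ) : Set where
  field
    vtx  : Fin 6 → V n k
    inj  : Injective _≡_ _≡_ vtx
    adj  : ∀ i → Adj n k (vtx i) (vtx (i ⊕ one))
open Cycle6 public

-- two cyclic sequences describe the same cycle iff they differ by a
-- rotation and possibly a reflection (dihedral action)
SameCycle : ∀ {n k} → Cycle6 n k → Cycle6 n k → Set
SameCycle c d = ∃ λ r → (∀ i → vtx d i ≡ vtx c (r ⊕ i)) ⊎ (∀ i → vtx d i ≡ vtx c (r ⊖ i))

Contains : ∀ {n k} → Cycle6 n k → V n k → Set
Contains c v = ∃ λ i → vtx c i ≡ v

uVert : (k : ℕ) → V 2 (suc k)
uVert zero    = Fin.suc (Fin.suc Fin.zero) , Fin.suc Fin.zero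
uVert (suc k) = Fin.zero , uVert k

-- In D_{k+1,n} every vertex has at most one bridge (an edge between two top-level copies), and two
-- copies are joined by at most one bridge. Hence a 6-cycle either stays inside one copy or alternates
-- bridges and internal edges through three distinct copies. For n = 2 the alternating case cannot
-- pass through (0, u): this would force some vertex to be adjacent to a vertex of uid 0, whose
-- neighbours have uid 1 or t_j, and either to have uid 5 or to be adjacent to u, whose far
-- neighbours have uid 6 t_j; both are impossible because t_j ≡ 2 (mod 4). So a 6-cycle through u
-- stays in copy 0 at every level and descends to D_{1,2}, which is itself a hexagon.
module Submission where

open import Defs
open import Data.Nat using (ℕ; zero; suc; _+_; _*_; _<_; _≤_; s≤s; s≤s⁻¹; z≤n; NonZero; >-nonZero)
open import Data.Nat.DivMod using (_%_; m<n⇒m%n≡m; [m+kn]%n≡m%n; %-distribˡ-+; %-distribˡ-*)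
open import Data.Nat.Properties
  using ( +-mono-≤; *-monoˡ-≤; ≤-trans; +-cancelˡ-≡; *-cancelʳ-≡; +-identityʳ; suc-injective
        ; <-asym; <-irrefl; <⇒≱; n≮0; m+n≡0⇒m≡0; m+n≡0⇒n≡0)
  renaming (_≟_ to _≟ℕ_; _<?_ to _<?ℕ_)
open import Data.Fin using (Fin; toℕ; #_) renaming (zero to fz; suc to fs)
open import Data.Fin.Properties using (toℕ-injective; toℕ<n; all?; any?; _≟_)
open import Data.Product using (Σ; _×_; _,_; proj₁; proj₂; ∃)
open import Data.Product.Properties using (≡-dec)
open import Data.Sum using (_⊎_; inj₁; inj₂)
open import Data.Empty using (⊥; ⊥-elim)
open import Function using (_∘_)
open import Relation.Nullary using (Dec; ¬?)
open import Relation.Nullary.Decidable using (from-yes; _×-dec_; _⊎-dec_; _→-dec_)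
open import Relation.Binary using (DecidableEquality)
open import Relation.Binary.PropositionalEquality
open ≡-Reasoning

mixed-radix-injective : ∀ {T a b i j} → a < T → b < T → a + i * T ≡ b + j * T → a ≡ b × i ≡ j
mixed-radix-injective {T} {a} {b} {i} {j} a<T b<T eq =
  a≡b , *-cancelʳ-≡ i j T (+-cancelˡ-≡ a _ _ (trans eq (cong (_+ j * T) (sym a≡b))))
  where
  instance
    T≢0 : NonZero T
    T≢0 = >-nonZero (≤-trans (s≤s z≤n) a<T)
  a≡b : a ≡ b
  a≡b = begin
    a              ≡⟨ m<n⇒m%n≡m a<T ⟨
    a % T          ≡⟨ [m+kn]%n≡m%n a i T ⟨
    (a + i * T) % T ≡⟨ cong (_% T) eq ⟩
    (b + j * T) % T ≡⟨ [m+kn]%n≡m%n b j T ⟩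
    b % T          ≡⟨ m<n⇒m%n≡m b<T ⟩
    b              ∎

uid<t : ∀ n k (x : V n k) → uid n k x < t n k
uid<t n zero    x       = toℕ<n x
uid<t n (suc k) (i , x) = +-mono-≤ (uid<t n k x) (*-monoˡ-≤ (t n k) (s≤s⁻¹ (toℕ<n i)))

uid-injective : ∀ n k {x y : V n k} → uid n k x ≡ uid n k y → x ≡ y
uid-injective n zero    eq = toℕ-injective eq
uid-injective n (suc k) {i , x} {j , y} eq
  with x≡y , i≡j ← mixed-radix-injective (uid<t n k x) (uid<t n k y) eq
  = cong₂ _,_ (toℕ-injective i≡j) (uid-injective n k x≡y)

_≟ᵥ_ : ∀ {n k} → DecidableEquality (V n k)
_≟ᵥ_ {k = zero}  = _≟_
_≟ᵥ_ {k = suc k} = ≡-dec _≟_ _≟ᵥ_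

Adj? : ∀ n k (x y : V n k) → Dec (Adj n k x y)
Adj? n zero    x       y       = ¬? (x ≟ y)
Adj? n (suc k) (i , x) (j , y) =
  (i ≟ j ×-dec Adj? n k x y)
  ⊎-dec (toℕ i <?ℕ toℕ j ×-dec suc (uid n k x) ≟ℕ toℕ j ×-dec uid n k y ≟ℕ toℕ i)
  ⊎-dec (toℕ j <?ℕ toℕ i ×-dec suc (uid n k y) ≟ℕ toℕ i ×-dec uid n k x ≟ℕ toℕ j)

Adj-sym : ∀ n k {x y : V n k} → Adj n k x y → Adj n k y x
Adj-sym n zero    x≢y                 = x≢y ∘ sym
Adj-sym n (suc k) (inj₁ (i≡j , x~y)) = inj₁ (sym i≡j , Adj-sym n k x~y)
Adj-sym n (suc k) (inj₂ (inj₁ b))     = inj₂ (inj₂ b)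
Adj-sym n (suc k) (inj₂ (inj₂ b))     = inj₂ (inj₁ b)

-- Adj n (suc k) w w' unfolds definitionally to Internal n k w w' ⊎ Bridge n k w w'.
copy : ∀ {n k} → V n (suc k) → Fin (suc (t n k))
copy = proj₁

Internal : ∀ n k → V n (suc k) → V n (suc k) → Set
Internal n k (i , x) (j , y) = i ≡ j × Adj n k x y

Bridge : ∀ n k → V n (suc k) → V n (suc k) → Set
Bridge n k (i , x) (j , y) =
    (toℕ i < toℕ j × suc (uid n k x) ≡ toℕ j × uid n k y ≡ toℕ i)
  ⊎ (toℕ j < toℕ i × suc (uid n k y) ≡ toℕ i × uid n k x ≡ toℕ j)

module Bridges (n k : ℕ) where

  Internal-sym : ∀ {w w'} → Internal n k w w' → Internal n k w' w
  Internal-sym (i≡j , x~y) = sym i≡j , Adj-sym n k x~y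

  Bridge-sym : ∀ {w w'} → Bridge n k w w' → Bridge n k w' w
  Bridge-sym (inj₁ b) = inj₂ b
  Bridge-sym (inj₂ b) = inj₁ b

  Bridge⇒copy≢ : ∀ {w w'} → Bridge n k w w' → copy w ≢ copy w'
  Bridge⇒copy≢ (inj₁ (i<j , _)) refl = <-irrefl refl i<j
  Bridge⇒copy≢ (inj₂ (j<i , _)) refl = <-irrefl refl j<i

  Bridge-functional : ∀ {w w₁ w₂} → Bridge n k w w₁ → Bridge n k w w₂ → w₁ ≡ w₂
  Bridge-functional (inj₁ (_ , e₁ , f₁)) (inj₁ (_ , e₂ , f₂)) =
    cong₂ _,_ (toℕ-injective (trans (sym e₁) e₂)) (uid-injective n k (trans f₁ (sym f₂)))
  Bridge-functional (inj₂ (_ , e₁ , f₁)) (inj₂ (_ , e₂ , f₂)) =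
    cong₂ _,_ (toℕ-injective (trans (sym f₁) f₂)) (uid-injective n k (suc-injective (trans e₁ (sym e₂))))
  Bridge-functional (inj₁ (i<j , e₁ , _)) (inj₂ (j<i , _ , f₂)) =
    ⊥-elim (<⇒≱ (subst (_< _) (sym f₂) j<i) (s≤s⁻¹ (subst (_ <_) (sym e₁) i<j)))
  Bridge-functional (inj₂ (j<i , _ , f₁)) (inj₁ (i<j , e₂ , _)) =
    ⊥-elim (<⇒≱ (subst (_< _) (sym f₁) j<i) (s≤s⁻¹ (subst (_ <_) (sym e₂) i<j)))

  Bridge-unique : ∀ {w₁ w₂ w₃ w₄} → Bridge n k w₁ w₂ → Bridge n k w₃ w₄ →
                  copy w₁ ≡ copy w₃ → copy w₂ ≡ copy w₄ → w₁ ≡ w₃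
  Bridge-unique (inj₁ (_ , e₁ , _)) (inj₁ (_ , e₃ , _)) refl refl =
    cong (_ ,_) (uid-injective n k (suc-injective (trans e₁ (sym e₃))))
  Bridge-unique (inj₂ (_ , _ , f₁)) (inj₂ (_ , _ , f₃)) refl refl =
    cong (_ ,_) (uid-injective n k (trans f₁ (sym f₃)))
  Bridge-unique (inj₁ (i<j , _)) (inj₂ (j<i , _)) refl refl = ⊥-elim (<-asym i<j j<i)
  Bridge-unique (inj₂ (j<i , _)) (inj₁ (i<j , _)) refl refl = ⊥-elim (<-asym i<j j<i)

  bridge-from-copy-0 : ∀ {x j y} → Bridge n k (fz , x) (j , y) → toℕ j ≡ suc (uid n k x) × uid n k y ≡ 0
  bridge-from-copy-0 (inj₁ (_ , e , f)) = sym e , f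
  bridge-from-copy-0 (inj₂ (() , _))

⊕-identityʳ : ∀ r → r ⊕ fz ≡ r
⊕-identityʳ = from-yes (all? λ r → r ⊕ fz ≟ r)

⊖-identityʳ : ∀ r → r ⊖ fz ≡ r
⊖-identityʳ = from-yes (all? λ r → r ⊖ fz ≟ r)

⊕-assoc-one : ∀ r i → (r ⊕ i) ⊕ one ≡ r ⊕ (i ⊕ one)
⊕-assoc-one = from-yes (all? λ r → all? λ i → (r ⊕ i) ⊕ one ≟ r ⊕ (i ⊕ one))

⊖-assoc-one : ∀ r i → (r ⊖ i) ⊖ one ≡ r ⊖ (i ⊕ one)
⊖-assoc-one = from-yes (all? λ r → all? λ i → (r ⊖ i) ⊖ one ≟ r ⊖ (i ⊕ one))

⊕-one-⊖-one : ∀ r i → (r ⊕ (i ⊕ one)) ⊖ one ≡ r ⊕ i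
⊕-one-⊖-one = from-yes (all? λ r → all? λ i → (r ⊕ (i ⊕ one)) ⊖ one ≟ r ⊕ i)

⊖-one-⊕-one : ∀ r i → (r ⊖ (i ⊕ one)) ⊕ one ≡ r ⊖ i
⊖-one-⊕-one = from-yes (all? λ r → all? λ i → (r ⊖ (i ⊕ one)) ⊕ one ≟ r ⊖ i)

⊕-⊖-inverse : ∀ r i → r ⊕ (i ⊖ r) ≡ i
⊕-⊖-inverse = from-yes (all? λ r → all? λ i → r ⊕ (i ⊖ r) ≟ i)

⊕-cancelˡ : ∀ r i j → r ⊕ i ≡ r ⊕ j → i ≡ j
⊕-cancelˡ = from-yes (all? λ r → all? λ i → all? λ j → r ⊕ i ≟ r ⊕ j →-dec i ≟ j)

⊕-one-⊕-one≢id : ∀ i → (i ⊕ one) ⊕ one ≢ i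
⊕-one-⊕-one≢id = from-yes (all? λ i → ¬? ((i ⊕ one) ⊕ one ≟ i))

cycle-induction : (P : Fin 6 → Set) → P (# 0) → P (# 1) →
                  (∀ i → P i → P (i ⊕ one) → P ((i ⊕ one) ⊕ one)) → ∀ i → P i
cycle-induction P p₀ p₁ step = λ where
    fz                          → p₀
    (fs fz)                     → p₁
    (fs (fs fz))                → p₂
    (fs (fs (fs fz)))           → p₃
    (fs (fs (fs (fs fz))))      → p₄
    (fs (fs (fs (fs (fs fz))))) → step (# 3) p₃ p₄
  where
  p₂ : P (# 2)
  p₂ = step (# 0) p₀ p₁
  p₃ : P (# 3)
  p₃ = step (# 1) p₁ p₂
  p₄ : P (# 4)
  p₄ = step (# 2) p₂ p₃

rotate : ∀ {n k} → Cycle6 n k → Fin 6 → Cycle6 n k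
vtx (rotate c r) i = vtx c (r ⊕ i)
inj (rotate c r) {i} {j} e = ⊕-cancelˡ r i j (inj c e)
adj (rotate {n} {k} c r) i = subst (Adj n k (vtx c (r ⊕ i)) ∘ vtx c) (⊕-assoc-one r i) (adj c (r ⊕ i))

all⊎any : ∀ {m} {A B : Fin m → Set} → (∀ i → A i ⊎ B i) → (∀ i → A i) ⊎ ∃ B
all⊎any {zero}  f = inj₁ λ ()
all⊎any {suc m} f with f fz | all⊎any (f ∘ fs)
... | inj₂ b | _            = inj₂ (fz , b)
... | inj₁ a | inj₂ (i , b) = inj₂ (fs i , b)
... | inj₁ a | inj₁ as      = inj₁ λ where
  fz     → a
  (fs i) → as i

module _ {n k : ℕ} where

  Alternating : (Fin 6 → V n (suc k)) → Set
  Alternating v =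
    Bridge n k (v (# 0)) (v (# 1)) × Internal n k (v (# 1)) (v (# 2)) × Bridge n k (v (# 2)) (v (# 3)) ×
    Internal n k (v (# 3)) (v (# 4)) × Bridge n k (v (# 4)) (v (# 5)) × Internal n k (v (# 5)) (v (# 0))

  Alternating-rotate₂ : ∀ v → Alternating v → Alternating (v ∘ ((# 2) ⊕_))
  Alternating-rotate₂ _ (b₀₁ , i₁₂ , b₂₃ , i₃₄ , b₄₅ , i₅₀) = b₂₃ , i₃₄ , b₄₅ , i₅₀ , b₀₁ , i₁₂

  Alternating-reflect : ∀ v → Alternating v → Alternating (v ∘ ((# 1) ⊖_))
  Alternating-reflect _ (b₀₁ , i₁₂ , b₂₃ , i₃₄ , b₄₅ , i₅₀) =
    Bridge-sym b₀₁ , Internal-sym i₅₀ , Bridge-sym b₄₅ , Internal-sym i₃₄ , Bridge-sym b₂₃ , Internal-sym i₁₂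
    where open Bridges n k

  bridge⇒alternating : (c : Cycle6 n (suc k)) → Bridge n k (vtx c (# 0)) (vtx c (# 1)) → Alternating (vtx c)
  bridge⇒alternating c b₀ = b₀ , i₁ , b₂ , i₃ , b₄ , i₅
    where
    open Bridges n k
    v : Fin 6 → V n (suc k)
    v = vtx c

    bridges-meet : ∀ a {b c'} → Bridge n k (v a) (v b) → Bridge n k (v b) (v c') → v a ≡ v c'
    bridges-meet a bab bbc = Bridge-functional (Bridge-sym bab) bbc

    i₁ : Internal n k (v (# 1)) (v (# 2))
    i₁ with adj c (# 1)
    ... | inj₁ i = i
    ... | inj₂ b with () ← inj c (bridges-meet (# 0) b₀ b)

    i₅ : Internal n k (v (# 5)) (v (# 0))
    i₅ with adj c (# 5)
    ... | inj₁ i = i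
    ... | inj₂ b with () ← inj c (bridges-meet (# 5) b b₀)

    b₂ : Bridge n k (v (# 2)) (v (# 3))
    b₂ with adj c (# 2) | adj c (# 3) | adj c (# 4)
    ... | inj₂ b | _ | _ = b
    ... | inj₁ _ | inj₂ b₃ | inj₂ b₄ with () ← inj c (bridges-meet (# 3) b₃ b₄)
    ... | inj₁ i₂ | inj₂ b₃ | inj₁ i₄
        with () ← inj c (Bridge-unique b₀ (Bridge-sym b₃)
                           (sym (trans (proj₁ i₄) (proj₁ i₅))) (trans (proj₁ i₁) (proj₁ i₂)))
    ... | inj₁ i₂ | inj₁ i₃ | inj₂ b₄
        with () ← inj c (Bridge-unique b₀ (Bridge-sym b₄)
                           (sym (proj₁ i₅)) (trans (proj₁ i₁) (trans (proj₁ i₂) (proj₁ i₃))))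
    ... | inj₁ i₂ | inj₁ i₃ | inj₁ i₄ = ⊥-elim (Bridge⇒copy≢ b₀
        (sym (trans (proj₁ i₁) (trans (proj₁ i₂) (trans (proj₁ i₃) (trans (proj₁ i₄) (proj₁ i₅)))))))

    i₃ : Internal n k (v (# 3)) (v (# 4))
    i₃ with adj c (# 3)
    ... | inj₁ i = i
    ... | inj₂ b with () ← inj c (bridges-meet (# 2) b₂ b)

    b₄ : Bridge n k (v (# 4)) (v (# 5))
    b₄ with adj c (# 4)
    ... | inj₂ b = b
    ... | inj₁ i₄
        with () ← inj c (Bridge-unique b₀ (Bridge-sym b₂)
                           (sym (trans (proj₁ i₃) (trans (proj₁ i₄) (proj₁ i₅)))) (proj₁ i₁))

  in-one-copy-or-alternating : (c : Cycle6 n (suc k)) →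
    (∀ i → copy (vtx c i) ≡ copy (vtx c (# 0))) ⊎ ∃ λ r → Alternating (vtx (rotate c r))
  in-one-copy-or-alternating c
    with all⊎any {A = λ i → Internal n k (vtx c i) (vtx c (i ⊕ one))} (adj c)
  ... | inj₁ internal = inj₁ (cycle-induction _ refl (sym (proj₁ (internal (# 0))))
                                λ i _ e → trans (sym (proj₁ (internal (i ⊕ one)))) e)
  ... | inj₂ (r , b) = inj₂ (r , bridge⇒alternating (rotate c r)
                                   (subst (λ s → Bridge n k (vtx c s) (vtx c (r ⊕ one))) (sym (⊕-identityʳ r)) b))

  restrict : (c : Cycle6 n (suc k)) {a : Fin (suc (t n k))} → (∀ i → copy (vtx c i) ≡ a) → Cycle6 n k
  vtx (restrict c h) i = proj₂ (vtx c i)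
  inj (restrict c h) {i} {j} e = inj c (cong₂ _,_ (trans (h i) (sym (h j))) e)
  adj (restrict c h) i with adj c i
  ... | inj₁ (_ , x~y) = x~y
  ... | inj₂ b         = ⊥-elim (Bridges.Bridge⇒copy≢ n k b (trans (h i) (sym (h (i ⊕ one)))))

  embed : Fin (suc (t n k)) → Cycle6 n k → Cycle6 n (suc k)
  vtx (embed a c) i = a , vtx c i
  inj (embed a c) e = inj c (cong proj₂ e)
  adj (embed a c) i = inj₁ (refl , adj c i)

  embed-SameCycle : ∀ {a} {c : Cycle6 n k} (d : Cycle6 n (suc k)) (h : ∀ i → copy (vtx d i) ≡ a) →
                    SameCycle c (restrict d h) → SameCycle (embed a c) d
  embed-SameCycle d h (r , inj₁ f) = r , inj₁ λ i → cong₂ _,_ (h i) (f i)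
  embed-SameCycle d h (r , inj₂ f) = r , inj₂ λ i → cong₂ _,_ (h i) (f i)

neighbour-of-origin : ∀ n k {w w' : V n k} → uid n k w ≡ 0 → Adj n k w w' →
                      uid n k w' < n ⊎ ∃ λ j → uid n k w' ≡ t n j
neighbour-of-origin n zero    {w' = w'} _ _ = inj₁ (toℕ<n w')
neighbour-of-origin n (suc k) {fs i , x} eq _ =
  ⊥-elim (n≮0 (subst (uid n k x <_) (m+n≡0⇒m≡0 (t n k) (m+n≡0⇒n≡0 (uid n k x) eq)) (uid<t n k x)))
neighbour-of-origin n (suc k) {fz , x} {j , y} eq (inj₁ (refl , x~y))
  with neighbour-of-origin n k (trans (sym (+-identityʳ _)) eq) x~y
... | inj₁ lt         = inj₁ (subst (_< n) (sym (+-identityʳ _)) lt)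
... | inj₂ (j' , e)   = inj₂ (j' , trans (+-identityʳ _) e)
neighbour-of-origin n (suc k) {fz , x} {j , y} eq (inj₂ b)
  with j≡1+x , y≡0 ← Bridges.bridge-from-copy-0 n k {x} {j} {y} b = inj₂ (k , (begin
    uid n k y + toℕ j * t n k ≡⟨ cong₂ (λ a b → a + b * t n k) y≡0 j≡1 ⟩
    t n k + 0                 ≡⟨ +-identityʳ _ ⟩
    t n k                     ∎))
  where
  j≡1 : toℕ j ≡ 1
  j≡1 = trans j≡1+x (cong suc (trans (sym (+-identityʳ _)) eq))

t₂≡2-mod-4 : ∀ j → t 2 j % 4 ≡ 2
t₂≡2-mod-4 zero    = refl
t₂≡2-mod-4 (suc j) = begin
  (suc T * T) % 4                     ≡⟨ %-distribˡ-* (suc T) T 4 ⟩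
  ((suc T % 4) * (T % 4)) % 4         ≡⟨ cong (λ s → (s * (T % 4)) % 4) (%-distribˡ-+ 1 T 4) ⟩
  (((1 + T % 4) % 4) * (T % 4)) % 4   ≡⟨ cong (λ s → (((1 + s) % 4) * s) % 4) (t₂≡2-mod-4 j) ⟩
  2                                   ∎
  where
  T : ℕ
  T = t 2 j

t₂≢5 : ∀ j → t 2 j ≢ 5
t₂≢5 j e with () ← trans (sym (t₂≡2-mod-4 j)) (cong (_% 4) e)

t₂≢6*t₂ : ∀ i j → t 2 i ≢ 6 * t 2 j
t₂≢6*t₂ i j e with () ← begin
  2                         ≡⟨ t₂≡2-mod-4 i ⟨
  t 2 i % 4                 ≡⟨ cong (_% 4) e ⟩
  (6 * t 2 j) % 4           ≡⟨ %-distribˡ-* 6 (t 2 j) 4 ⟩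
  (2 * (t 2 j % 4)) % 4     ≡⟨ cong (λ s → (2 * s) % 4) (t₂≡2-mod-4 j) ⟩
  0                         ∎

hex : Fin 6 → V 2 1
hex fz                          = fz , fz
hex (fs fz)                     = fz , # 1
hex (fs (fs fz))                = # 2 , fz
hex (fs (fs (fs fz)))           = # 2 , # 1
hex (fs (fs (fs (fs fz))))      = # 1 , # 1
hex (fs (fs (fs (fs (fs fz))))) = # 1 , fz

hexagon : Cycle6 2 1
vtx hexagon = hex
inj hexagon {i} {j} = from-yes (all? λ i → all? λ j → hex i ≟ᵥ hex j →-dec i ≟ j) i j
adj hexagon = from-yes (all? λ i → Adj? 2 1 (hex i) (hex (i ⊕ one)))

hex-surjective : ∀ w → ∃ λ r → w ≡ hex r
hex-surjective (i , x) = from-yes (all? λ i → all? λ x → any? λ r → (i , x) ≟ᵥ hex r) i x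

hex-neighbours : ∀ j w → Adj 2 1 (hex j) w → w ≡ hex (j ⊕ one) ⊎ w ≡ hex (j ⊖ one)
hex-neighbours j (i , x) = from-yes (all? λ j → all? λ i → all? λ x →
  Adj? 2 1 (hex j) (i , x) →-dec ((i , x) ≟ᵥ hex (j ⊕ one) ⊎-dec (i , x) ≟ᵥ hex (j ⊖ one))) j i x

module _ (d : Cycle6 2 1) where

  hex-successor : ∀ i j → vtx d i ≡ hex j →
                  vtx d (i ⊕ one) ≡ hex (j ⊕ one) ⊎ vtx d (i ⊕ one) ≡ hex (j ⊖ one)
  hex-successor i j dᵢ = hex-neighbours j _ (subst (λ w → Adj 2 1 w (vtx d (i ⊕ one))) dᵢ (adj d i))

  hex-forward-step : ∀ r i → vtx d i ≡ hex (r ⊕ i) → vtx d (i ⊕ one) ≡ hex (r ⊕ (i ⊕ one)) →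
                     vtx d ((i ⊕ one) ⊕ one) ≡ hex (r ⊕ ((i ⊕ one) ⊕ one))
  hex-forward-step r i dᵢ dᵢ₊₁ with hex-successor (i ⊕ one) _ dᵢ₊₁
  ... | inj₁ e = trans e (cong hex (⊕-assoc-one r (i ⊕ one)))
  ... | inj₂ e = ⊥-elim (⊕-one-⊕-one≢id i (inj d (trans e (trans (cong hex (⊕-one-⊖-one r i)) (sym dᵢ)))))

  hex-backward-step : ∀ r i → vtx d i ≡ hex (r ⊖ i) → vtx d (i ⊕ one) ≡ hex (r ⊖ (i ⊕ one)) →
                      vtx d ((i ⊕ one) ⊕ one) ≡ hex (r ⊖ ((i ⊕ one) ⊕ one))
  hex-backward-step r i dᵢ dᵢ₊₁ with hex-successor (i ⊕ one) _ dᵢ₊₁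
  ... | inj₂ e = trans e (cong hex (⊖-assoc-one r (i ⊕ one)))
  ... | inj₁ e = ⊥-elim (⊕-one-⊕-one≢id i (inj d (trans e (trans (cong hex (⊖-one-⊕-one r i)) (sym dᵢ)))))

  hexagon-unique : SameCycle hexagon d
  hexagon-unique with r , d₀ ← hex-surjective (vtx d (# 0)) with hex-successor (# 0) r d₀
  ... | inj₁ d₁ = r , inj₁ (cycle-induction _ (trans d₀ (cong hex (sym (⊕-identityʳ r)))) d₁ (hex-forward-step r))
  ... | inj₂ d₁ = r , inj₂ (cycle-induction _ (trans d₀ (cong hex (sym (⊖-identityʳ r)))) d₁ (hex-backward-step r))

uid-uVert : ∀ k → uid 2 (suc k) (uVert k) ≡ 5
uid-uVert zero    = refl
uid-uVert (suc k) = trans (+-identityʳ _) (uid-uVert k)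

neighbour-of-u : ∀ k {w} → Adj 2 (suc k) (uVert k) w →
                 uid 2 (suc k) w ≡ 3 ⊎ uid 2 (suc k) w ≡ 4 ⊎ ∃ λ j → uid 2 (suc k) w ≡ 6 * t 2 j
neighbour-of-u zero    u~w with hex-neighbours (# 3) _ u~w
... | inj₁ refl = inj₁ refl
... | inj₂ refl = inj₂ (inj₁ refl)
neighbour-of-u (suc k) {j , y} (inj₁ (refl , u~y)) with neighbour-of-u k u~y
... | inj₁ e              = inj₁ (trans (+-identityʳ _) e)
... | inj₂ (inj₁ e)       = inj₂ (inj₁ (trans (+-identityʳ _) e))
... | inj₂ (inj₂ (i , e)) = inj₂ (inj₂ (i , trans (+-identityʳ _) e))
neighbour-of-u (suc k) {j , y} (inj₂ b)
  with j≡1+u , y≡0 ← Bridges.bridge-from-copy-0 2 (suc k) {uVert k} {j} {y} b =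
  inj₂ (inj₂ (suc k , cong₂ (λ a b → a + b * t 2 (suc k)) y≡0 (trans j≡1+u (cong suc (uid-uVert k)))))

module _ (k : ℕ) where
  open Bridges 2 (suc k)

  bridge-from-u : ∀ {j y} → Bridge 2 (suc k) (fz , uVert k) (j , y) → toℕ j ≡ 6 × uid 2 (suc k) y ≡ 0
  bridge-from-u {j} {y} b with j≡1+u , y≡0 ← bridge-from-copy-0 {uVert k} {j} {y} b =
    trans j≡1+u (cong suc (uid-uVert k)) , y≡0

  no-alternating-hexagon-through-u : ∀ {w₀ w₁ w₂ w₃ w₄ w₅ : V 2 (suc (suc k))} →
    Bridge 2 (suc k) w₀ w₁ → Internal 2 (suc k) w₁ w₂ → Bridge 2 (suc k) w₂ w₃ →
    Internal 2 (suc k) w₃ w₄ → Bridge 2 (suc k) w₄ w₅ → Internal 2 (suc k) w₅ w₀ → w₀ ≢ (fz , uVert k)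
  -- The outer bridges leave copy 0 from u towards copy 6 and from a neighbour x' of u towards copy
  -- uid x' + 1, landing on vertices of uid 0; the middle bridge between these copies is then impossible.
  no-alternating-hexagon-through-u {w₁ = B , y} {_ , y'} {C , z'} {_ , z} {_ , x'}
    b₀₁ (refl , y~y') b₂₃ (refl , z'~z) b₄₅ (refl , x'~u) refl
    with B≡6 , uid-y≡0 ← bridge-from-u {B} {y} b₀₁
       | C≡1+x' , uid-z≡0 ← bridge-from-copy-0 {x'} {C} {z} (Bridge-sym {C , z} {fz , x'} b₄₅)
    with b₂₃
  ... | inj₁ (B<C , 1+y'≡C , _) =
    far-neighbours (s≤s⁻¹ (subst₂ _<_ B≡6 C≡1+x' B<C)) (suc-injective (trans 1+y'≡C C≡1+x'))
      (neighbour-of-origin 2 (suc k) {y} {y'} uid-y≡0 y~y') (neighbour-of-u k (Adj-sym 2 (suc k) {x'} x'~u))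
    where
    far-neighbours : ∀ {m m'} → 6 ≤ m → m' ≡ m → m' < 2 ⊎ (∃ λ i → m' ≡ t 2 i) →
                     m ≡ 3 ⊎ m ≡ 4 ⊎ (∃ λ j → m ≡ 6 * t 2 j) → ⊥
    far-neighbours (s≤s (s≤s (s≤s ())))      _    _              (inj₁ refl)
    far-neighbours (s≤s (s≤s (s≤s (s≤s ())))) _    _              (inj₂ (inj₁ refl))
    far-neighbours 6≤m  refl (inj₁ m<2)     (inj₂ (inj₂ _))        = <⇒≱ m<2 (≤-trans (s≤s (s≤s z≤n)) 6≤m)
    far-neighbours _    refl (inj₂ (i , e)) (inj₂ (inj₂ (j , e'))) = t₂≢6*t₂ i j (trans (sym e) e')
  ... | inj₂ (_ , 1+z'≡B , _)
    with z'≡5 ← suc-injective (trans 1+z'≡B B≡6)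
    with neighbour-of-origin 2 (suc k) {z} {z'} uid-z≡0 (Adj-sym 2 (suc k) {z'} z'~z)
  ... | inj₁ z'<2    = <⇒≱ z'<2 (subst (2 ≤_) (sym z'≡5) (s≤s (s≤s z≤n)))
  ... | inj₂ (j , e) = t₂≢5 j (trans (sym e) z'≡5)

  alternating-avoids-u-at-0 : (w : Fin 6 → V 2 (suc (suc k))) → Alternating w → w (# 0) ≢ (fz , uVert k)
  alternating-avoids-u-at-0 w (b₀₁ , i₁₂ , b₂₃ , i₃₄ , b₄₅ , i₅₀) =
    no-alternating-hexagon-through-u {w (# 0)} {w (# 1)} {w (# 2)} {w (# 3)} {w (# 4)} {w (# 5)}
      b₀₁ i₁₂ b₂₃ i₃₄ b₄₅ i₅₀

  alternating-avoids-u-near-0 : (w : Fin 6 → V 2 (suc (suc k))) → Alternating w →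
                                w (# 0) ≢ (fz , uVert k) × w (# 1) ≢ (fz , uVert k)
  alternating-avoids-u-near-0 w alt =
    alternating-avoids-u-at-0 w alt , alternating-avoids-u-at-0 (w ∘ ((# 1) ⊖_)) (Alternating-reflect w alt)

  alternating-avoids-u : (w : Fin 6 → V 2 (suc (suc k))) → Alternating w → ∀ p → w p ≢ (fz , uVert k)
  alternating-avoids-u w alt = λ where
      fz                          → proj₁ (alternating-avoids-u-near-0 w alt)
      (fs fz)                     → proj₂ (alternating-avoids-u-near-0 w alt)
      (fs (fs fz))                → proj₁ (alternating-avoids-u-near-0 w₂ alt₂)
      (fs (fs (fs fz)))           → proj₂ (alternating-avoids-u-near-0 w₂ alt₂)
      (fs (fs (fs (fs fz))))      → proj₁ (alternating-avoids-u-near-0 w₄ alt₄)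
      (fs (fs (fs (fs (fs fz))))) → proj₂ (alternating-avoids-u-near-0 w₄ alt₄)
    where
    w₂ w₄ : Fin 6 → V 2 (suc (suc k))
    w₂ = w ∘ ((# 2) ⊕_)
    w₄ = w₂ ∘ ((# 2) ⊕_)
    alt₂ : Alternating w₂
    alt₂ = Alternating-rotate₂ w alt
    alt₄ : Alternating w₄
    alt₄ = Alternating-rotate₂ w₂ alt₂

  cycle-through-u-in-copy-0 : (c : Cycle6 2 (suc (suc k))) → Contains c (fz , uVert k) → ∀ i → copy (vtx c i) ≡ fz
  cycle-through-u-in-copy-0 c (p , cₚ≡u) with in-one-copy-or-alternating c
  ... | inj₁ same-copy = λ i → trans (same-copy i) (trans (sym (same-copy p)) (cong copy cₚ≡u))
  ... | inj₂ (r , alt) =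
    ⊥-elim (alternating-avoids-u (vtx (rotate c r)) alt (p ⊖ r) (trans (cong (vtx c) (⊕-⊖-inverse r p)) cₚ≡u))

uCycle : ∀ k → Cycle6 2 (suc k)
uCycle zero    = hexagon
uCycle (suc k) = embed fz (uCycle k)

uCycle-contains-u : ∀ k → Contains (uCycle k) (uVert k)
uCycle-contains-u zero    = # 3 , refl
uCycle-contains-u (suc k) with p , e ← uCycle-contains-u k = p , cong (fz ,_) e

uCycle-unique : ∀ k (d : Cycle6 2 (suc k)) → Contains d (uVert k) → SameCycle (uCycle k) d
uCycle-unique zero    d _          = hexagon-unique d
uCycle-unique (suc k) d (p , dₚ≡u) =
  embed-SameCycle {c = uCycle k} d in-copy-0 (uCycle-unique k (restrict d in-copy-0) (p , cong proj₂ dₚ≡u))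
  where
  in-copy-0 : ∀ i → copy (vtx d i) ≡ fz
  in-copy-0 = cycle-through-u-in-copy-0 k d (p , dₚ≡u)

lemma4 : (m : ℕ) →
    Σ (Cycle6 2 (suc (suc m))) (λ c →
      Contains c (uVert (suc m)) ×
      ((d : Cycle6 2 (suc (suc m))) → Contains d (uVert (suc m)) → SameCycle c d))
lemma4 m = uCycle (suc m) , uCycle-contains-u (suc m) , uCycle-unique (suc m)
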